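{- Let $G$ be a finite digraph and $P$ a finite poset. If the edges (2-walks) of $G$ are $P$-colorable, then $\chi(G)\le |A(P)|$.
   Context: A digraph has finite vertex set $V$ and edges that are ordered pairs of distinct vertices; write $u\to v$ for an edge. A 2-walk is a pair $(v_1v_2)$ with $v_1\to v_2$, and a 3-walk is $(v_1v_2v_3)$ with $v_1\to v_2\to v_3$. A $P$-coloring of the 2-walks is a map $c$ from edges to $P$ with $c(v_1v_2)\not\le c(v_2v_3)$ for every 3-walk $(v_1v_2v_3)$. $A(P)$ is the set of all antichains of $P$ (including the empty one). $\chi(G)$ is the chromatic number of the undirected graph on $V$ with edge $\{u,v\}$ iff $u\to v$ or $v\to u$. -}

module Defs where

open import Level using (Level; _⊔_)
open import Data.Nat using (ℕ; zero; suc; _≤_; _^_)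
open import Data.Bool using (Bool; true; false)
open import Data.Fin using (Fin)
open import Data.Fin.Subset using (Subset; _∈_)
open import Data.List using (List; []; _∷_; _++_; map; length; filter)
open import Data.Vec using (Vec; []; _∷_)
open import Data.Product using (Σ; _×_; _,_)
open import Relation.Nullary using (¬_; Dec)
open import Relation.Unary using (Pred; Decidable)
open import Relation.Binary.PropositionalEquality using (_≡_; _≢_)
open import Relation.Binary.Structures using (IsDecPartialOrder)

record Digraph (n : ℕ) : Set₁ where
  field
    edge   : Fin n → Fin n → Bool
    irrefl : ∀ x → edge x x ≡ false

  -- u → v  (a proposition: at most one proof)
  _⇒_ : Fin n → Fin n → Set
  x ⇒ y = edge x y ≡ true

-- Finite posets: carrier Fin m with a (decidable) partial order w.r.t. ≡.
-- (Every finite poset is isomorphic to one of these.)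

record FinPoset (m : ℕ) : Set₁ where
  field
    _≼_   : Fin m → Fin m → Set
    isDPO : IsDecPartialOrder _≡_ _≼_

module _ {n m : ℕ} (G : Digraph n) (P : FinPoset m) where
  open Digraph G
  open FinPoset P

  IsPColoring : (∀ {a b} → a ⇒ b → Fin m) → Set
  IsPColoring c = ∀ {a b d} (p : a ⇒ b) (q : b ⇒ d) → ¬ (c p ≼ c q)

  PColorable : Set
  PColorable = Σ (∀ {a b} → a ⇒ b → Fin m) IsPColoring

-- Chromatic number bound: χ(G) ≤ k iff the underlying undirected graph
-- (u ~ w iff u → w or w → u) has a proper coloring with k colors.

module _ {n : ℕ} (G : Digraph n) where
  open Digraph G

  ProperColoring : ℕ → Set
  ProperColoring k = Σ (Fin n → Fin k) λ f → ∀ {a b} → a ⇒ b → f a ≢ f b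

  χ≤ : ℕ → Set
  χ≤ k = ProperColoring k

-- All 2^m subsets of Fin m (each listed exactly once).
allSubsets : (m : ℕ) → List (Subset m)
allSubsets zero    = [] ∷ []
allSubsets (suc m) = map (false ∷_) (allSubsets m) ++ map (true ∷_) (allSubsets m)

module _ {m : ℕ} (P : FinPoset m) where
  open FinPoset P

  IsAntichain : Subset m → Set
  IsAntichain S = ∀ {x y} → x ∈ S → y ∈ S → x ≢ y → ¬ (x ≼ y)

module _ {m : ℕ} (P : FinPoset m) where
  open FinPoset P
  open IsDecPartialOrder isDPO using (_≟_; _≤?_)
  open import Data.Fin.Subset.Properties using (_∈?_)
  open import Relation.Nullary using (yes; no)
  open import Relation.Nullary.Decidable using (map′)
  open import Data.Fin.Properties using (all?)
  open import Relation.Nullary.Decidable using (_→-dec_; ¬?)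

  antichain? : Decidable (IsAntichain P)
  antichain? S = map′ to from
      (all? λ x → all? λ y →
        (x ∈? S) →-dec ((y ∈? S) →-dec (¬? (x ≟ y) →-dec ¬? (x ≤? y))))
    where
    to : _ → IsAntichain P S
    to h {x} {y} = h x y
    from : IsAntichain P S → _
    from h x y = h

  -- |A(P)|: the number of antichains of P (empty one included).
  numAntichains : ℕ
  numAntichains = length (filter antichain? (allSubsets m))

{-# OPTIONS --safe #-}
-- Colour each vertex v by the set of minimal elements of the colours of the
-- edges entering v; this is an antichain of P. If u → v and u, v got the same
-- antichain, pick y minimal among the in-colours of v below c(u → v). Then y
-- is also minimal among the in-colours of u, so y = c(w → u) for some w, and
-- c(w → u) ≤ c(u → v) contradicts the colouring condition on the 3-walk w u v.
module Submission where

open import Defs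
open import Data.Nat using (ℕ)
open import Data.Bool using (true; false)
import Data.Bool as Bool
open import Data.Fin using (Fin)
open import Data.Fin.Properties using (any?; all?)
open import Data.Fin.Induction using (po-wellFounded)
open import Data.Fin.Subset using (Subset) renaming (_∈_ to _∈ₛ_)
open import Data.Vec using ([]; _∷_; tabulate)
open import Data.Vec.Properties using ([]=⇒lookup; lookup⇒[]=; lookup∘tabulate)
open import Data.List using (List; filter)
open import Data.List.Membership.Propositional using (_∈_)
open import Data.List.Membership.Propositional.Properties using (∈-map⁺; ∈-++⁺ˡ; ∈-++⁺ʳ; ∈-filter⁺)
open import Data.List.Membership.Setoid.Properties using (index-injective)
open import Data.List.Relation.Unary.Any using (here; index)
open import Data.Product using (Σ; ∃-syntax; _×_; _,_; proj₁; proj₂)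
open import Function using (_∘_)
open import Level using (Level; 0ℓ)
open import Relation.Nullary using (Dec; yes; no; does; proof)
open import Relation.Nullary.Decidable using (map′; _×-dec_; _→-dec_; dec-true; decidable-stable)
open import Relation.Nullary.Reflects using (Reflects; invert)
open import Relation.Unary using (Pred; Decidable)
open import Relation.Binary.PropositionalEquality using (_≡_; _≢_; refl; sym; trans; subst; setoid)
open import Relation.Binary.Structures using (IsDecPartialOrder)
open import Induction.WellFounded using (Acc; acc)
open import Axiom.UniquenessOfIdentityProofs using (module Decidable⇒UIP)

private
  variable
    ℓ : Level
    m n : ℕ

∈-allSubsets : (S : Subset m) → S ∈ allSubsets m
∈-allSubsets []          = here refl
∈-allSubsets (false ∷ S) = ∈-++⁺ˡ (∈-map⁺ (false ∷_) (∈-allSubsets S))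
∈-allSubsets (true ∷ S)  = ∈-++⁺ʳ _ (∈-map⁺ (true ∷_) (∈-allSubsets S))

module _ {Q : Pred (Fin m) ℓ} (Q? : Decidable Q) where

  toSubset : Subset m
  toSubset = tabulate (does ∘ Q?)

  ∈-toSubset⁺ : ∀ {x} → Q x → x ∈ₛ toSubset
  ∈-toSubset⁺ {x} Qx = lookup⇒[]= x toSubset (trans (lookup∘tabulate _ x) (dec-true (Q? x) Qx))

  ∈-toSubset⁻ : ∀ {x} → x ∈ₛ toSubset → Q x
  ∈-toSubset⁻ {x} x∈S = invert (subst (Reflects (Q x)) does≡true (proof (Q? x)))
    where
    does≡true : does (Q? x) ≡ true
    does≡true = trans (sym (lookup∘tabulate _ x)) ([]=⇒lookup x∈S)

module _ (P : FinPoset m) where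
  open FinPoset P
  open IsDecPartialOrder isDPO
    using (_≟_; _≤?_; isPartialOrder) renaming (refl to ≼-refl; trans to ≼-trans)
  open import Relation.Binary.Construct.NonStrictToStrict _≡_ _≼_ using (_<_; <-decidable)

  antichains : List (Subset m)
  antichains = filter (antichain? P) (allSubsets m)

  ∈-antichains : ∀ {S} → IsAntichain P S → S ∈ antichains
  ∈-antichains {S} = ∈-filter⁺ (antichain? P) (∈-allSubsets S)

  IsMinimal : Pred (Fin m) ℓ → Pred (Fin m) ℓ
  IsMinimal Q x = Q x × (∀ y → Q y → y ≼ x → y ≡ x)

  module _ {Q : Pred (Fin m) ℓ} (Q? : Decidable Q) where

    isMinimal? : Decidable (IsMinimal Q)
    isMinimal? x = Q? x ×-dec all? λ y → Q? y →-dec (y ≤? x →-dec y ≟ x)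

    minimals : Subset m
    minimals = toSubset isMinimal?

    minimals-antichain : IsAntichain P minimals
    minimals-antichain x∈ y∈ x≢y x≼y =
      x≢y (proj₂ (∈-toSubset⁻ isMinimal? y∈) _ (proj₁ (∈-toSubset⁻ isMinimal? x∈)) x≼y)

    minimal-below : ∀ {x} → Q x → ∃[ y ] y ≼ x × IsMinimal Q y
    minimal-below {x} = go (po-wellFounded isPartialOrder x)
      where
      go : ∀ {x} → Acc _<_ x → Q x → ∃[ y ] y ≼ x × IsMinimal Q y
      go {x} (acc smaller) Qx with any? (λ y → Q? y ×-dec <-decidable _≟_ _≤?_ y x)
      ... | yes (y , Qy , y<x) =
        let z , z≼y , z-min = go (smaller y<x) Qy in z , ≼-trans z≼y (proj₁ y<x) , z-min
      ... | no ∄Q-below =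
        x , ≼-refl , Qx , λ y Qy y≼x →
          decidable-stable (y ≟ x) λ y≢x → ∄Q-below (y , Qy , y≼x , y≢x)

module _ (G : Digraph n) (P : FinPoset m) (c : ∀ {a b} → Digraph._⇒_ G a b → Fin m) where
  open Digraph G
  open FinPoset P
  open IsDecPartialOrder isDPO using (_≟_)

  ⇒-irrelevant : ∀ {a b} (e e′ : a ⇒ b) → e ≡ e′
  ⇒-irrelevant = Decidable⇒UIP.≡-irrelevant Bool._≟_

  InColour : Fin n → Pred (Fin m) 0ℓ
  InColour v x = ∃[ u ] Σ (u ⇒ v) λ e → c e ≡ x

  inColour? : ∀ v → Decidable (InColour v)
  inColour? v x = any? edgeWithColour?
    where
    edgeWithColour? : ∀ u → Dec (Σ (u ⇒ v) λ e → c e ≡ x)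
    edgeWithColour? u with edge u v Bool.≟ true
    ... | no ¬e = no (¬e ∘ proj₁)
    ... | yes e = map′ (e ,_) from-any-edge (c e ≟ x)
      where
      from-any-edge : Σ (u ⇒ v) (λ e′ → c e′ ≡ x) → c e ≡ x
      from-any-edge (e′ , ce′≡x) = subst (λ e″ → c e″ ≡ x) (⇒-irrelevant e′ e) ce′≡x

  minimalInColours : Fin n → Subset m
  minimalInColours v = minimals P (inColour? v)

  minimalInColours-adjacent-≢ : IsPColoring G P c →
                                ∀ {u v} → u ⇒ v → minimalInColours u ≢ minimalInColours v
  minimalInColours-adjacent-≢ c-ok {u} {v} e same =
    let y , y≼ce , y-minimal-at-v = minimal-below P (inColour? v) (u , e , refl)
        y∈minimals-at-v = ∈-toSubset⁺ (isMinimal? P (inColour? v)) y-minimal-at-v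
        y∈minimals-at-u = subst (y ∈ₛ_) (sym same) y∈minimals-at-v
        (_ , e′ , ce′≡y) , _ = ∈-toSubset⁻ (isMinimal? P (inColour? u)) y∈minimals-at-u
    in c-ok e′ e (subst (_≼ c e) (sym ce′≡y) y≼ce)

mainTheorem11 : {n m : ℕ} (G : Digraph n) (P : FinPoset m) →
                PColorable G P → χ≤ G (numAntichains P)
mainTheorem11 G P (c , c-ok) = colour , colour-proper
  where
  open Digraph G using (_⇒_)

  colour : Fin _ → Fin (numAntichains P)
  colour v = index (∈-antichains P (minimals-antichain P (inColour? G P c v)))

  colour-proper : ∀ {u v} → u ⇒ v → colour u ≢ colour v
  colour-proper e same =
    minimalInColours-adjacent-≢ G P c c-ok e (index-injective (setoid _) _ _ same)
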